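{- Let $A$ and $B$ be formulas. There is a derivation from $A$ to $B$ using only the rules $\{\mathsf w,\mathsf c,\equiv\}$ if and only if there is a derivation from $A$ to $B$ using only the rules $\{\mathsf w,\mathsf w_\forall,\mathsf{ac},\mathsf c_\forall,\mathsf m,\mathsf m_\forall,\mathsf m_\exists,\equiv\}$.
   Context: Formulas: terms $t::=x\mid f(t_1,\dots,t_n)$; atoms $a::=\mathsf t\mid\mathsf f\mid p(\vec t)\mid\bar p(\vec t)$; formulas $A::=a\mid A\wedge A\mid A\vee A\mid\exists x.A\mid\forall x.A$. $\equiv$ is the smallest congruence with $\wedge,\vee$ commutative and associative, $\forall x\forall y.A\equiv\forall y\forall x.A$, $\exists x\exists y.A\equiv\exists y\exists x.A$, $\forall x.(A\vee B)\equiv(\forall x.A)\vee B$, $\exists x.(A\wedge B)\equiv(\exists x.A)\wedge B$ ($x$ not free in $B$). A context $S\{\ \}$ is a formula with one hole in place of an atom. A derivation from $B$ to $A$ is a finite sequence of formulas from $B$ to $A$, each step a rule instance. Rules (premise $\Rightarrow$ conclusion in any context $S$): $\mathsf w$: $S\{A\}\Rightarrow S\{A\vee B\}$; $\mathsf c$: $S\{A\vee A\}\Rightarrow S\{A\}$; $\equiv$: $S\{B\}\Rightarrow S\{A\}$ if $A\equiv B$; $\mathsf{ac}$: $S\{a\vee a\}\Rightarrow S\{a\}$ ($a$ an atom); $\mathsf m$: $S\{(A\wedge C)\vee(B\wedge D)\}\Rightarrow S\{(A\vee B)\wedge(C\vee D)\}$; $\mathsf m_\forall$: $S\{(\forall x.A)\vee(\forall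 x.B)\}\Rightarrow S\{\forall x.(A\vee B)\}$; $\mathsf m_\exists$: $S\{(\exists x.A)\vee(\exists x.B)\}\Rightarrow S\{\exists x.(A\vee B)\}$; $\mathsf w_\forall$: $S\{A\}\Rightarrow S\{\forall x.A\}$ ($x$ not free in $A$); $\mathsf c_\forall$: $S\{\forall x.\forall x.A\}\Rightarrow S\{\forall x.A\}$. -}

module Defs where

open import Data.Nat using (ℕ)
open import Data.List using (List)
open import Data.List.Relation.Unary.Any using (Any)
open import Data.Sum using (_⊎_)
open import Data.Product using (_×_)
open import Relation.Nullary using (¬_)
open import Relation.Binary.PropositionalEquality using (_≢_)

Var : Set
Var = ℕ

data Term : Set where
  var : Var → Term
  fun : ℕ → List Term → Term

data Atom : Set where
  tt ff : Atom
  pos : ℕ → List Term → Atom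
  neg : ℕ → List Term → Atom

data Formula : Set where
  atom : Atom → Formula
  _∧_  : Formula → Formula → Formula
  _∨_  : Formula → Formula → Formula
  ex   : Var → Formula → Formula
  all  : Var → Formula → Formula

infixr 6 _∧_
infixr 5 _∨_

data _∈ₜ_ (x : Var) : Term → Set where
  here  : x ∈ₜ var x
  infun : ∀ {f ts} → Any (x ∈ₜ_) ts → x ∈ₜ fun f ts

data _∈ₐ_ (x : Var) : Atom → Set where
  inpos : ∀ {p ts} → Any (x ∈ₜ_) ts → x ∈ₐ pos p ts
  inneg : ∀ {p ts} → Any (x ∈ₜ_) ts → x ∈ₐ neg p ts

data FreeIn (x : Var) : Formula → Set where
  fatom : ∀ {a} → x ∈ₐ a → FreeIn x (atom a)
  f∧l   : ∀ {A B} → FreeIn x A → FreeIn x (A ∧ B)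
  f∧r   : ∀ {A B} → FreeIn x B → FreeIn x (A ∧ B)
  f∨l   : ∀ {A B} → FreeIn x A → FreeIn x (A ∨ B)
  f∨r   : ∀ {A B} → FreeIn x B → FreeIn x (A ∨ B)
  fex   : ∀ {y A} → x ≢ y → FreeIn x A → FreeIn x (ex y A)
  fall  : ∀ {y A} → x ≢ y → FreeIn x A → FreeIn x (all y A)

data _≅_ : Formula → Formula → Set where
  ≅-refl  : ∀ {A} → A ≅ A
  ≅-sym   : ∀ {A B} → A ≅ B → B ≅ A
  ≅-trans : ∀ {A B C} → A ≅ B → B ≅ C → A ≅ C
  ≅-∧     : ∀ {A A' B B'} → A ≅ A' → B ≅ B' → (A ∧ B) ≅ (A' ∧ B')
  ≅-∨     : ∀ {A A' B B'} → A ≅ A' → B ≅ B' → (A ∨ B) ≅ (A' ∨ B')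
  ≅-ex    : ∀ {x A A'} → A ≅ A' → ex x A ≅ ex x A'
  ≅-all   : ∀ {x A A'} → A ≅ A' → all x A ≅ all x A'
  ∧-comm  : ∀ {A B} → (A ∧ B) ≅ (B ∧ A)
  ∨-comm  : ∀ {A B} → (A ∨ B) ≅ (B ∨ A)
  ∧-assoc : ∀ {A B C} → ((A ∧ B) ∧ C) ≅ (A ∧ (B ∧ C))
  ∨-assoc : ∀ {A B C} → ((A ∨ B) ∨ C) ≅ (A ∨ (B ∨ C))
  all-swap : ∀ {x y A} → all x (all y A) ≅ all y (all x A)
  ex-swap  : ∀ {x y A} → ex x (ex y A) ≅ ex y (ex x A)
  all-∨    : ∀ {x A B} → ¬ FreeIn x B → all x (A ∨ B) ≅ (all x A ∨ B)
  ex-∧     : ∀ {x A B} → ¬ FreeIn x B → ex x (A ∧ B) ≅ (ex x A ∧ B)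

data Ctx : Set where
  □    : Ctx
  _∧ₗ_ : Ctx → Formula → Ctx
  _∧ᵣ_ : Formula → Ctx → Ctx
  _∨ₗ_ : Ctx → Formula → Ctx
  _∨ᵣ_ : Formula → Ctx → Ctx
  exC  : Var → Ctx → Ctx
  allC : Var → Ctx → Ctx

-- S{A}: plugging (literally, no renaming) a formula into the hole
_[_] : Ctx → Formula → Formula
□ [ A ] = A
(S ∧ₗ B) [ A ] = S [ A ] ∧ B
(B ∧ᵣ S) [ A ] = B ∧ S [ A ]
(S ∨ₗ B) [ A ] = S [ A ] ∨ B
(B ∨ᵣ S) [ A ] = B ∨ S [ A ]
exC x S [ A ] = ex x (S [ A ])
allC x S [ A ] = all x (S [ A ])

data Rule : Set where
  w c eqv ac m m∀ m∃ w∀ c∀ : Rule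

-- shallow rule instances: Inst r P Q means "P ⇒ Q" (premise P, conclusion Q)
data Inst : Rule → Formula → Formula → Set where
  i-w   : ∀ {A B} → Inst w A (A ∨ B)
  i-c   : ∀ {A} → Inst c (A ∨ A) A
  i-eqv : ∀ {A B} → A ≅ B → Inst eqv B A
  i-ac  : ∀ {a} → Inst ac (atom a ∨ atom a) (atom a)
  i-m   : ∀ {A B C D} → Inst m ((A ∧ C) ∨ (B ∧ D)) ((A ∨ B) ∧ (C ∨ D))
  i-m∀  : ∀ {x A B} → Inst m∀ (all x A ∨ all x B) (all x (A ∨ B))
  i-m∃  : ∀ {x A B} → Inst m∃ (ex x A ∨ ex x B) (ex x (A ∨ B))
  i-w∀  : ∀ {x A} → ¬ FreeIn x A → Inst w∀ A (all x A)
  i-c∀  : ∀ {x A} → Inst c∀ (all x (all x A)) (all x A)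

data Step (r : Rule) : Formula → Formula → Set where
  step : ∀ {P Q} (S : Ctx) → Inst r P Q → Step r (S [ P ]) (S [ Q ])

data Derivation (R : Rule → Set) : Formula → Formula → Set where
  done : ∀ {A} → Derivation R A A
  _∷_  : ∀ {A B C r} → R r × Step r A B → Derivation R B C → Derivation R A C

data SysWC : Rule → Set where
  in-w : SysWC w
  in-c : SysWC c
  in-eqv : SysWC eqv

data SysM : Rule → Set where
  in-w : SysM w
  in-w∀ : SysM w∀
  in-ac : SysM ac
  in-c∀ : SysM c∀
  in-m : SysM m
  in-m∀ : SysM m∀
  in-m∃ : SysM m∃
  in-eqv : SysM eqv

{-# OPTIONS --safe #-}
module Submission where

-- Derivations can be pushed into any context, so it suffices to derive each rule
-- of one system in the other.  With medial rules, contraction of an arbitrary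
-- formula reduces by induction to atomic contraction.  Conversely, with w, c and
-- ≡, each medial rule follows by weakening both disjuncts of its premise to its
-- conclusion and contracting; w∀ and c∀ combine weakening, contraction and the
-- ≡-law ∀x.(A ∨ B) ≡ (∀x.A) ∨ B.

open import Defs
open import Function.Bundles using (_⇔_; mk⇔)
open import Data.Product using (_,_)
open import Relation.Binary.PropositionalEquality using (_≡_; refl; cong; subst₂)
open import Relation.Nullary using (¬_)

infixr 7 _∘ᶜ_

_∘ᶜ_ : Ctx → Ctx → Ctx
□ ∘ᶜ T = T
(S ∧ₗ B) ∘ᶜ T = (S ∘ᶜ T) ∧ₗ B
(B ∧ᵣ S) ∘ᶜ T = B ∧ᵣ (S ∘ᶜ T)
(S ∨ₗ B) ∘ᶜ T = (S ∘ᶜ T) ∨ₗ B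
(B ∨ᵣ S) ∘ᶜ T = B ∨ᵣ (S ∘ᶜ T)
exC x S ∘ᶜ T = exC x (S ∘ᶜ T)
allC x S ∘ᶜ T = allC x (S ∘ᶜ T)

plug-∘ᶜ : ∀ S T P → (S ∘ᶜ T) [ P ] ≡ S [ T [ P ] ]
plug-∘ᶜ □ T P = refl
plug-∘ᶜ (S ∧ₗ B) T P = cong (_∧ B) (plug-∘ᶜ S T P)
plug-∘ᶜ (B ∧ᵣ S) T P = cong (B ∧_) (plug-∘ᶜ S T P)
plug-∘ᶜ (S ∨ₗ B) T P = cong (_∨ B) (plug-∘ᶜ S T P)
plug-∘ᶜ (B ∨ᵣ S) T P = cong (B ∨_) (plug-∘ᶜ S T P)
plug-∘ᶜ (exC x S) T P = cong (ex x) (plug-∘ᶜ S T P)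
plug-∘ᶜ (allC x S) T P = cong (all x) (plug-∘ᶜ S T P)

module _ {R : Rule → Set} where

  infixr 4 _++_

  _++_ : ∀ {A B C} → Derivation R A B → Derivation R B C → Derivation R A C
  done ++ e = e
  (s ∷ d) ++ e = s ∷ (d ++ e)

  rule : ∀ {r P Q} → R r → Inst r P Q → Derivation R P Q
  rule r i = (r , step □ i) ∷ done

  ≅-derive : ∀ {A B} → R eqv → A ≅ B → Derivation R A B
  ≅-derive r A≅B = rule r (i-eqv (≅-sym A≅B))

  inCtx : ∀ {A B} (S : Ctx) → Derivation R A B → Derivation R (S [ A ]) (S [ B ])
  inCtx S done = done
  inCtx S ((r , step {P} {Q} T i) ∷ d) =
    (r , subst₂ (Step _) (plug-∘ᶜ S T P) (plug-∘ᶜ S T Q) (step (S ∘ᶜ T) i)) ∷ inCtx S d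

  ∧-mono : ∀ {A A′ B B′} → Derivation R A A′ → Derivation R B B′ → Derivation R (A ∧ B) (A′ ∧ B′)
  ∧-mono {A′ = A′} {B} d e = inCtx (□ ∧ₗ B) d ++ inCtx (A′ ∧ᵣ □) e

  ∨-mono : ∀ {A A′ B B′} → Derivation R A A′ → Derivation R B B′ → Derivation R (A ∨ B) (A′ ∨ B′)
  ∨-mono {A′ = A′} {B} d e = inCtx (□ ∨ₗ B) d ++ inCtx (A′ ∨ᵣ □) e

  ex-mono : ∀ {x A B} → Derivation R A B → Derivation R (ex x A) (ex x B)
  ex-mono {x} = inCtx (exC x □)

  all-mono : ∀ {x A B} → Derivation R A B → Derivation R (all x A) (all x B)
  all-mono {x} = inCtx (allC x □)

simulate : ∀ {R R′ : Rule → Set} →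
           (∀ {r P Q} → R r → Inst r P Q → Derivation R′ P Q) →
           ∀ {A B} → Derivation R A B → Derivation R′ A B
simulate sim done = done
simulate sim ((r , step S i) ∷ d) = inCtx S (sim r i) ++ simulate sim d

∨-interchange : ∀ {A B C D} → ((A ∨ B) ∨ (C ∨ D)) ≅ ((A ∨ C) ∨ (B ∨ D))
∨-interchange = ≅-trans ∨-assoc (≅-trans (≅-∨ ≅-refl (≅-sym ∨-assoc))
                  (≅-trans (≅-∨ ≅-refl (≅-∨ ∨-comm ≅-refl))
                  (≅-trans (≅-∨ ≅-refl ∨-assoc) (≅-sym ∨-assoc))))

bound-not-free : ∀ {x A} → ¬ FreeIn x (all x A)
bound-not-free (fall x≢x _) = x≢x refl

contractᴹ : (A : Formula) → Derivation SysM (A ∨ A) A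
contractᴹ (atom a) = rule in-ac i-ac
contractᴹ (B ∧ C) = rule in-m i-m ++ ∧-mono (contractᴹ B) (contractᴹ C)
contractᴹ (B ∨ C) = ≅-derive in-eqv ∨-interchange ++ ∨-mono (contractᴹ B) (contractᴹ C)
contractᴹ (ex x B) = rule in-m∃ i-m∃ ++ ex-mono (contractᴹ B)
contractᴹ (all x B) = rule in-m∀ i-m∀ ++ all-mono (contractᴹ B)

simulateWC : ∀ {r P Q} → SysWC r → Inst r P Q → Derivation SysM P Q
simulateWC in-w i = rule in-w i
simulateWC in-c (i-c {A}) = contractᴹ A
simulateWC in-eqv i = rule in-eqv i

weakenˡ : ∀ {A B} → Derivation SysWC A (A ∨ B)
weakenˡ = rule in-w i-w

weakenʳ : ∀ {A B} → Derivation SysWC A (B ∨ A)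
weakenʳ = weakenˡ ++ ≅-derive in-eqv ∨-comm

contractᵂ : ∀ {A} → Derivation SysWC (A ∨ A) A
contractᵂ = rule in-c i-c

∨-join : ∀ {A B C} → Derivation SysWC A C → Derivation SysWC B C → Derivation SysWC (A ∨ B) C
∨-join d e = ∨-mono d e ++ contractᵂ

simulateM : ∀ {r P Q} → SysM r → Inst r P Q → Derivation SysWC P Q
simulateM in-w i = rule in-w i
simulateM in-eqv i = rule in-eqv i
simulateM in-ac i-ac = contractᵂ
simulateM in-w∀ (i-w∀ x∉A) = weakenʳ ++ ≅-derive in-eqv (≅-sym (all-∨ x∉A)) ++ all-mono contractᵂ
simulateM in-c∀ i-c∀ = all-mono weakenʳ ++ ≅-derive in-eqv (all-∨ bound-not-free) ++ contractᵂ
simulateM in-m i-m = ∨-join (∧-mono weakenˡ weakenˡ) (∧-mono weakenʳ weakenʳ)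
simulateM in-m∀ i-m∀ = ∨-join (all-mono weakenˡ) (all-mono weakenʳ)
simulateM in-m∃ i-m∃ = ∨-join (ex-mono weakenˡ) (ex-mono weakenʳ)

lemma7p8 : (A B : Formula) → Derivation SysWC A B ⇔ Derivation SysM A B
lemma7p8 A B = mk⇔ (simulate simulateWC) (simulate simulateM)
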